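{- Let $A=\{i_1,\dots,i_n\}\subseteq[m]$, fix $\ell\in[m]\setminus A$, and let $\mathcal{G}_\ell=\{B\subseteq[m]: B\setminus A=\{\ell\},\ |B|=n\text{ or }|B|=n-1\}$ and $K=\mathcal{VR}(\mathcal{G}_\ell;3)$. Then every maximal face of $K$ is the intersection of $\mathcal{G}_\ell$ with a set of one of the following forms: (i) $N[\{\ell\}\cup A]\cup N[\{\ell\}\cup B]$ where $B$ is an $(n-1)$-element subset of $A$; (ii) $N[\{\ell\}\cup A]\cup H^{i_a,i_b,i_c}_{\{\ell\}\cup A}$ where $i_a,i_b,i_c\in A$.
   Context: Subsets of $[m]$ carry the metric $d(C,D)=|C\Delta D|$; $\mathcal{VR}(X;r)$ is the simplicial complex on $X$ whose simplices are nonempty finite subsets of diameter $\le r$. For $C\subseteq[m]$, $N[C]=\{C\}\cup\{D\subseteq[m]:|C\Delta D|=1\}$. For $j_1,\dots,j_k\in[m]$, $C^{j_1,\dots,j_k}=C\Delta\{j_1,\dots,j_k\}$, and $H^{j_1,j_2,j_3}_C=\{C,C^{j_1,j_2},C^{j_1,j_3},C^{j_2,j_3}\}$. -}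

module Defs where

open import Data.Nat using (ℕ; _≤_; _∸_)
open import Data.Bool using (Bool; true; false; _∧_; _∨_; _xor_)
open import Data.Fin using (Fin)
open import Data.Fin.Subset using (Subset; ⁅_⁆; _∪_; _─_; ∣_∣)
open import Data.Vec.Properties using (≡-dec)
import Data.Bool as 𝔹
open import Relation.Binary.Definitions using (DecidableEquality)
open import Data.Vec using (zipWith)
open import Data.Product using (Σ; ∃; _×_)
open import Relation.Binary.PropositionalEquality using (_≡_)
open import Relation.Nullary.Decidable using (⌊_⌋)
import Data.Nat as ℕ

_≟_ : ∀ {m} → DecidableEquality (Subset m)
_≟_ = ≡-dec 𝔹._≟_

_Δ_ : ∀ {m} → Subset m → Subset m → Subset m
C Δ D = zipWith _xor_ C D

dist : ∀ {m} → Subset m → Subset m → ℕ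
dist C D = ∣ C Δ D ∣

Family : ℕ → Set
Family m = Subset m → Bool

_∈F_ : ∀ {m} → Subset m → Family m → Set
C ∈F σ = σ C ≡ true

_⊆F_ : ∀ {m} → Family m → Family m → Set
σ ⊆F τ = ∀ C → C ∈F σ → C ∈F τ

_∪F_ : ∀ {m} → Family m → Family m → Family m
(σ ∪F τ) C = σ C ∨ τ C

_∩F_ : ∀ {m} → Family m → Family m → Family m
(σ ∩F τ) C = σ C ∧ τ C

_≐F_ : ∀ {m} → Family m → Family m → Set
σ ≐F τ = ∀ C → σ C ≡ τ C

singletonF : ∀ {m} → Subset m → Family m
singletonF C D = ⌊ C ≟ D ⌋

-- Simplices of VR(X; r): nonempty (automatically finite) subfamilies of X
-- of diameter ≤ r.
IsVRSimplex : ∀ {m} → Family m → ℕ → Family m → Set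
IsVRSimplex X r σ =
  (∃ λ C → C ∈F σ) × (σ ⊆F X) ×
  (∀ C D → C ∈F σ → D ∈F σ → dist C D ≤ r)

IsMaximalFace : ∀ {m} → Family m → ℕ → Family m → Set
IsMaximalFace X r σ =
  IsVRSimplex X r σ ×
  (∀ τ → IsVRSimplex X r τ → σ ⊆F τ → τ ⊆F σ)

N[_] : ∀ {m} → Subset m → Family m
N[ C ] D = ⌊ C ≟ D ⌋ ∨ ⌊ dist C D ℕ.≟ 1 ⌋

_^[_,_] : ∀ {m} → Subset m → Fin m → Fin m → Subset m
C ^[ j₁ , j₂ ] = C Δ (⁅ j₁ ⁆ ∪ ⁅ j₂ ⁆)

H : ∀ {m} → Subset m → Fin m → Fin m → Fin m → Family m
H C j₁ j₂ j₃ =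
  singletonF C ∪F (singletonF (C ^[ j₁ , j₂ ]) ∪F
  (singletonF (C ^[ j₁ , j₃ ]) ∪F singletonF (C ^[ j₂ , j₃ ])))

G : ∀ {m} → Subset m → Fin m → Family m
G A ℓ B = ⌊ (B ─ A) ≟ ⁅ ℓ ⁆ ⌋ ∧
          (⌊ ∣ B ∣ ℕ.≟ ∣ A ∣ ⌋ ∨ ⌊ ∣ B ∣ ℕ.≟ (∣ A ∣ ∸ 1) ⌋)

-- Translation by S = {ℓ} ∪ A, C ↦ S Δ C, is an isometry of the cube sending G_ℓ into the
-- 1- and 2-element subsets of A. Two such sets are at distance ≤ 3 unless both have two
-- elements and are disjoint, so the 2-element images of a simplex form a pairwise
-- intersecting family of edges on A: a star around some i, or a triangle {ab, ac, bc}.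
-- All of G whose image is a singleton or an edge of that star (resp. a side of that
-- triangle) still has diameter ≤ 3, so by maximality σ is G ∩ (N[S] ∪ N[S Δ {i}]), where
-- S Δ {i} = {ℓ} ∪ (A ∖ {i}), or G ∩ (N[S] ∪ H^{a,b,c}_S).

module Submission where

open import Defs
open import Data.Nat using (ℕ; _∸_)
open import Data.Fin using (Fin)
open import Data.Fin.Subset using (Subset; ⁅_⁆; _∪_; _⊆_; _∈_; _∉_; ∣_∣)
open import Data.Product using (Σ; ∃; _×_; _,_)
open import Data.Sum using (_⊎_)
open import Relation.Binary.PropositionalEquality using (_≡_; _≢_)

open import Data.Bool using (true; false; _∧_; _∨_)
import Data.Bool as Bool
open import Data.Bool.Properties using (xor-assoc; xor-comm; xor-identityˡ; ⇔→≡)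
open import Data.Fin using (zero; suc)
open import Data.Fin.Subset using (_∩_; _─_; ⊥; Nonempty; Empty)
open import Data.Fin.Subset.Properties
  using (x∈⁅x⁆; x∈⁅y⁆⇒x≡y; ∣⁅x⁆∣≡1; ∣⊥∣≡0; x∈p∪q⁺; x∈p∪q⁻;
         x∈p∩q⁺; x∈p∩q⁻; ∪-identityˡ; ∪-comm; drop-there; drop-∷-⊆;
         p─q⊆p; x∈p∧x∉q⇒x∈p─q; p⊆q⇒∣p∣≤∣q∣; Empty-unique; nonempty?; _∈?_;
         anySubset?)
import Data.Fin.Properties as Finₚ
import Data.Nat as ℕ
open import Data.Nat using (suc; _+_; _≤_; _<_; z≤n; s≤s)
open import Data.Nat.Properties
  using (+-suc; +-identityʳ; +-cancelʳ-≡; suc-injective; m+n∸n≡m; m≤m+n;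
         +-monoʳ-≤; +-mono-≤; +-cancelʳ-≤; m≤n⇒m≤1+n; ≤-reflexive; module ≤-Reasoning)
open import Data.Product using (∃₂; proj₁; proj₂)
open import Data.Sum using (inj₁; inj₂)
open import Data.Vec using ([]; _∷_; here; there)
open import Data.Vec.Properties using (zipWith-assoc; zipWith-comm; zipWith-identityˡ)
open import Function.Bundles using (mk⇔)
open import Relation.Nullary using (Dec; yes; no; ¬?; contradiction)
open import Relation.Nullary.Decidable using (⌊_⌋; _×-dec_; decidable-stable)
open import Relation.Unary using (Decidable)
open import Relation.Binary.PropositionalEquality
  using (refl; sym; trans; cong; cong₂; subst; module ≡-Reasoning)

∧-≡true⁻ : ∀ {a b} → a ∧ b ≡ true → a ≡ true × b ≡ true
∧-≡true⁻ {true} b≡true = refl , b≡true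

∧-≡true⁺ : ∀ {a b} → a ≡ true → b ≡ true → a ∧ b ≡ true
∧-≡true⁺ refl b≡true = b≡true

∨-≡true⁻ : ∀ {a b} → a ∨ b ≡ true → a ≡ true ⊎ b ≡ true
∨-≡true⁻ {true}  _      = inj₁ refl
∨-≡true⁻ {false} b≡true = inj₂ b≡true

∨-≡true⁺ˡ : ∀ {a} b → a ≡ true → a ∨ b ≡ true
∨-≡true⁺ˡ _ refl = refl

∨-≡true⁺ʳ : ∀ a {b} → b ≡ true → a ∨ b ≡ true
∨-≡true⁺ʳ true  _      = refl
∨-≡true⁺ʳ false b≡true = b≡true

⌊⌋-≡true⁻ : ∀ {P : Set} (P? : Dec P) → ⌊ P? ⌋ ≡ true → P
⌊⌋-≡true⁻ (yes p) _ = p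

⌊⌋-≡true⁺ : ∀ {P : Set} (P? : Dec P) → P → ⌊ P? ⌋ ≡ true
⌊⌋-≡true⁺ (yes _) _ = refl
⌊⌋-≡true⁺ (no ¬p) p = contradiction p ¬p

Δ-self : ∀ {m} (p : Subset m) → p Δ p ≡ ⊥
Δ-self []          = refl
Δ-self (true  ∷ p) = cong (false ∷_) (Δ-self p)
Δ-self (false ∷ p) = cong (false ∷_) (Δ-self p)

module _ {m : ℕ} where

  Δ-assoc : (p q r : Subset m) → (p Δ q) Δ r ≡ p Δ (q Δ r)
  Δ-assoc = zipWith-assoc xor-assoc

  Δ-comm : (p q : Subset m) → p Δ q ≡ q Δ p
  Δ-comm = zipWith-comm xor-comm

  Δ-identityˡ : (p : Subset m) → ⊥ Δ p ≡ p
  Δ-identityˡ = zipWith-identityˡ xor-identityˡ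

  Δ-cancelˡ : (p q : Subset m) → p Δ (p Δ q) ≡ q
  Δ-cancelˡ p q = begin
    p Δ (p Δ q)  ≡⟨ sym (Δ-assoc p p q) ⟩
    (p Δ p) Δ q  ≡⟨ cong (_Δ q) (Δ-self p) ⟩
    ⊥ Δ q        ≡⟨ Δ-identityˡ q ⟩
    q            ∎
    where open ≡-Reasoning

  Δ-transpose : ∀ {p q r : Subset m} → p Δ q ≡ r → p Δ r ≡ q
  Δ-transpose {p} {q} refl = Δ-cancelˡ p q

  Δ-swap : (p q r : Subset m) → (p Δ q) Δ r ≡ q Δ (p Δ r)
  Δ-swap p q r = begin
    (p Δ q) Δ r  ≡⟨ cong (_Δ r) (Δ-comm p q) ⟩
    (q Δ p) Δ r  ≡⟨ Δ-assoc q p r ⟩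
    q Δ (p Δ r)  ∎
    where open ≡-Reasoning

  dist-Δˡ : (p q r : Subset m) → dist (p Δ q) (p Δ r) ≡ dist q r
  dist-Δˡ p q r = cong ∣_∣ (trans (Δ-swap p q (p Δ r)) (cong (q Δ_) (Δ-cancelˡ p r)))

  ∣pΔp∣≡0 : (p : Subset m) → ∣ p Δ p ∣ ≡ 0
  ∣pΔp∣≡0 p = trans (cong ∣_∣ (Δ-self p)) (∣⊥∣≡0 m)

∈Δ-⊆⁻ : ∀ {m} {p q : Subset m} {x} → q ⊆ p → x ∈ p Δ q → x ∈ p × x ∉ q
∈Δ-⊆⁻ {p = true ∷ p}  {true  ∷ q} {zero}  _   ()
∈Δ-⊆⁻ {p = true ∷ p}  {false ∷ q} {zero}  _   here = here , λ ()
∈Δ-⊆⁻ {p = false ∷ p} {true  ∷ q} {zero}  q⊆p here with q⊆p here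
... | ()
∈Δ-⊆⁻ {p = _ ∷ p}    {_ ∷ q}     {suc x} q⊆p (there x∈pΔq)
  with ∈Δ-⊆⁻ (drop-∷-⊆ q⊆p) x∈pΔq
... | x∈p , x∉q = there x∈p , λ x∈q → x∉q (drop-there x∈q)

⁅x⁆∪p≡⁅x⁆Δp : ∀ {m} {x : Fin m} {p} → x ∉ p → ⁅ x ⁆ ∪ p ≡ ⁅ x ⁆ Δ p
⁅x⁆∪p≡⁅x⁆Δp {x = zero}  {true  ∷ p} x∉p = contradiction here x∉p
⁅x⁆∪p≡⁅x⁆Δp {x = zero}  {false ∷ p} _   =
  cong (true ∷_) (trans (∪-identityˡ p) (sym (Δ-identityˡ p)))
⁅x⁆∪p≡⁅x⁆Δp {x = suc x} {b ∷ p}     x∉p =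
  cong (b ∷_) (⁅x⁆∪p≡⁅x⁆Δp (λ x∈p → x∉p (there x∈p)))

∣Δ∣+2∣∩∣≡∣∣+∣∣ : ∀ {m} (p q : Subset m) →
                ∣ p Δ q ∣ + (∣ p ∩ q ∣ + ∣ p ∩ q ∣) ≡ ∣ p ∣ + ∣ q ∣
∣Δ∣+2∣∩∣≡∣∣+∣∣ []          []          = refl
∣Δ∣+2∣∩∣≡∣∣+∣∣ (true ∷ p)  (true ∷ q)  = begin
  r + (suc k + suc k)       ≡⟨ cong (λ n → r + suc n) (+-suc k k) ⟩
  r + suc (suc (k + k))     ≡⟨ +-suc r (suc (k + k)) ⟩
  suc (r + suc (k + k))     ≡⟨ cong suc (+-suc r (k + k)) ⟩
  suc (suc (r + (k + k)))   ≡⟨ cong (λ n → suc (suc n)) (∣Δ∣+2∣∩∣≡∣∣+∣∣ p q) ⟩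
  suc (suc (∣ p ∣ + ∣ q ∣)) ≡⟨ cong suc (+-suc ∣ p ∣ ∣ q ∣) ⟨
  suc ∣ p ∣ + suc ∣ q ∣     ∎
  where
  open ≡-Reasoning
  r = ∣ p Δ q ∣
  k = ∣ p ∩ q ∣
∣Δ∣+2∣∩∣≡∣∣+∣∣ (true ∷ p)  (false ∷ q) = cong suc (∣Δ∣+2∣∩∣≡∣∣+∣∣ p q)
∣Δ∣+2∣∩∣≡∣∣+∣∣ (false ∷ p) (true ∷ q)  =
  trans (cong suc (∣Δ∣+2∣∩∣≡∣∣+∣∣ p q)) (sym (+-suc _ _))
∣Δ∣+2∣∩∣≡∣∣+∣∣ (false ∷ p) (false ∷ q) = ∣Δ∣+2∣∩∣≡∣∣+∣∣ p q

∣Δ∣+∣∣≡∣∣ : ∀ {m} {p q : Subset m} → q ⊆ p → ∣ p Δ q ∣ + ∣ q ∣ ≡ ∣ p ∣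
∣Δ∣+∣∣≡∣∣ {p = []}        {[]}        _   = refl
∣Δ∣+∣∣≡∣∣ {p = true ∷ p}  {true ∷ q}  q⊆p =
  trans (+-suc _ _) (cong suc (∣Δ∣+∣∣≡∣∣ (drop-∷-⊆ q⊆p)))
∣Δ∣+∣∣≡∣∣ {p = true ∷ p}  {false ∷ q} q⊆p = cong suc (∣Δ∣+∣∣≡∣∣ (drop-∷-⊆ q⊆p))
∣Δ∣+∣∣≡∣∣ {p = false ∷ p} {true ∷ q}  q⊆p with q⊆p here
... | ()
∣Δ∣+∣∣≡∣∣ {p = false ∷ p} {false ∷ q} q⊆p = ∣Δ∣+∣∣≡∣∣ (drop-∷-⊆ q⊆p)

∣⁅x⁆∪p∣≡1+∣p∣ : ∀ {m} {x : Fin m} {p} → x ∉ p → ∣ ⁅ x ⁆ ∪ p ∣ ≡ suc ∣ p ∣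
∣⁅x⁆∪p∣≡1+∣p∣ {x = zero}  {true  ∷ p} x∉p = contradiction here x∉p
∣⁅x⁆∪p∣≡1+∣p∣ {x = zero}  {false ∷ p} _   = cong (λ q → suc ∣ q ∣) (∪-identityˡ p)
∣⁅x⁆∪p∣≡1+∣p∣ {x = suc x} {true  ∷ p} x∉p = cong suc (∣⁅x⁆∪p∣≡1+∣p∣ (λ x∈p → x∉p (there x∈p)))
∣⁅x⁆∪p∣≡1+∣p∣ {x = suc x} {false ∷ p} x∉p = ∣⁅x⁆∪p∣≡1+∣p∣ (λ x∈p → x∉p (there x∈p))

Empty⇒∣p∣≡0 : ∀ {m} {p : Subset m} → Empty p → ∣ p ∣ ≡ 0
Empty⇒∣p∣≡0 {m} p-empty = trans (cong ∣_∣ (Empty-unique p-empty)) (∣⊥∣≡0 m)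

0<∣p∣⇒Nonempty : ∀ {m} {p : Subset m} → 0 < ∣ p ∣ → Nonempty p
0<∣p∣⇒Nonempty {p = p} 0<∣p∣ with nonempty? p
... | yes p-nonempty = p-nonempty
... | no  p-empty    with () ← subst (0 <_) (Empty⇒∣p∣≡0 p-empty) 0<∣p∣

∈∩⇒Nonempty : ∀ {m} {p q : Subset m} {x} → x ∈ p → x ∈ q → Nonempty (p ∩ q)
∈∩⇒Nonempty x∈p x∈q = _ , x∈p∩q⁺ (x∈p , x∈q)

x∈p⇒⁅x⁆⊆p : ∀ {m} {p : Subset m} {x} → x ∈ p → ⁅ x ⁆ ⊆ p
x∈p⇒⁅x⁆⊆p {x = x} x∈p y∈⁅x⁆ = subst (_∈ _) (sym (x∈⁅y⁆⇒x≡y x y∈⁅x⁆)) x∈p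

x∈p⇒∣pΔ⁅x⁆∣≡∣p∣∸1 : ∀ {m} {p : Subset m} {x} → x ∈ p → ∣ p Δ ⁅ x ⁆ ∣ ≡ ∣ p ∣ ∸ 1
x∈p⇒∣pΔ⁅x⁆∣≡∣p∣∸1 {p = p} {x} x∈p = begin
  ∣ p Δ ⁅ x ⁆ ∣                   ≡⟨ sym (m+n∸n≡m _ 1) ⟩
  ∣ p Δ ⁅ x ⁆ ∣ + 1 ∸ 1           ≡⟨ cong (λ n → ∣ p Δ ⁅ x ⁆ ∣ + n ∸ 1) (sym (∣⁅x⁆∣≡1 x)) ⟩
  ∣ p Δ ⁅ x ⁆ ∣ + ∣ ⁅ x ⁆ ∣ ∸ 1   ≡⟨ cong (_∸ 1) (∣Δ∣+∣∣≡∣∣ (x∈p⇒⁅x⁆⊆p x∈p)) ⟩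
  ∣ p ∣ ∸ 1                       ∎
  where open ≡-Reasoning

pΔ⁅x⁆⊆p : ∀ {m} {p : Subset m} {x} → x ∈ p → p Δ ⁅ x ⁆ ⊆ p
pΔ⁅x⁆⊆p x∈p y∈pΔ⁅x⁆ = proj₁ (∈Δ-⊆⁻ (x∈p⇒⁅x⁆⊆p x∈p) y∈pΔ⁅x⁆)

x∉p⇒Empty[⁅x⁆∩p] : ∀ {m} {p : Subset m} {x} → x ∉ p → Empty (⁅ x ⁆ ∩ p)
x∉p⇒Empty[⁅x⁆∩p] {p = p} {x} x∉p (y , y∈⁅x⁆∩p) with x∈p∩q⁻ ⁅ x ⁆ p y∈⁅x⁆∩p
... | y∈⁅x⁆ , y∈p = x∉p (subst (_∈ p) (x∈⁅y⁆⇒x≡y x y∈⁅x⁆) y∈p)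

pair : ∀ {m} → Fin m → Fin m → Subset m
pair x y = ⁅ x ⁆ ∪ ⁅ y ⁆

module _ {m : ℕ} {x y : Fin m} where

  x∈pair : x ∈ pair x y
  x∈pair = x∈p∪q⁺ (inj₁ (x∈⁅x⁆ x))

  y∈pair : y ∈ pair x y
  y∈pair = x∈p∪q⁺ (inj₂ (x∈⁅x⁆ y))

  ∈pair⁻ : ∀ {z} → z ∈ pair x y → z ≡ x ⊎ z ≡ y
  ∈pair⁻ z∈pair with x∈p∪q⁻ ⁅ x ⁆ ⁅ y ⁆ z∈pair
  ... | inj₁ z∈⁅x⁆ = inj₁ (x∈⁅y⁆⇒x≡y x z∈⁅x⁆)
  ... | inj₂ z∈⁅y⁆ = inj₂ (x∈⁅y⁆⇒x≡y y z∈⁅y⁆)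

  pair-meet⁻ : ∀ {p} → Nonempty (pair x y ∩ p) → x ∈ p ⊎ y ∈ p
  pair-meet⁻ {p} (z , z∈pair∩p) with x∈p∩q⁻ (pair x y) p z∈pair∩p
  ... | z∈pair , z∈p with ∈pair⁻ z∈pair
  ...   | inj₁ refl = inj₁ z∈p
  ...   | inj₂ refl = inj₂ z∈p

pair-comm : ∀ {m} (x y : Fin m) → pair x y ≡ pair y x
pair-comm x y = ∪-comm ⁅ x ⁆ ⁅ y ⁆

∣p∣≡0⇒p≡⊥ : ∀ {m} {p : Subset m} → ∣ p ∣ ≡ 0 → p ≡ ⊥
∣p∣≡0⇒p≡⊥ {p = []}        _ = refl
∣p∣≡0⇒p≡⊥ {p = false ∷ p} e = cong (false ∷_) (∣p∣≡0⇒p≡⊥ e)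

∣p∣≡1⇒singleton : ∀ {m} {p : Subset m} → ∣ p ∣ ≡ 1 → ∃ λ x → p ≡ ⁅ x ⁆
∣p∣≡1⇒singleton {p = true ∷ p}  e = zero , cong (true ∷_) (∣p∣≡0⇒p≡⊥ (suc-injective e))
∣p∣≡1⇒singleton {p = false ∷ p} e with ∣p∣≡1⇒singleton {p = p} e
... | x , refl = suc x , refl

∣p∣≡2⇒pair : ∀ {m} {p : Subset m} → ∣ p ∣ ≡ 2 → ∃₂ λ x y → x ≢ y × p ≡ pair x y
∣p∣≡2⇒pair {p = true ∷ p}  e with ∣p∣≡1⇒singleton {p = p} (suc-injective e)
... | x , refl = zero , suc x , (λ ()) , cong (true ∷_) (sym (∪-identityˡ ⁅ x ⁆))
∣p∣≡2⇒pair {p = false ∷ p} e with ∣p∣≡2⇒pair {p = p} e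
... | x , y , x≢y , refl = suc x , suc y , (λ sx≡sy → x≢y (Finₚ.suc-injective sx≡sy)) , refl

module _ {m : ℕ} {p : Subset m} (∣p∣≡2 : ∣ p ∣ ≡ 2) where

  ∣p∣≡2∧x∈p⇒pair : ∀ {x} → x ∈ p → ∃ λ y → x ≢ y × p ≡ pair x y
  ∣p∣≡2∧x∈p⇒pair x∈p with ∣p∣≡2⇒pair {p = p} ∣p∣≡2
  ... | u , v , u≢v , refl with ∈pair⁻ x∈p
  ...   | inj₁ refl = v , u≢v , refl
  ...   | inj₂ refl = u , (λ v≡u → u≢v (sym v≡u)) , pair-comm u v

  ∣p∣≡2∧x,y∈p⇒pair : ∀ {x y} → x ≢ y → x ∈ p → y ∈ p → p ≡ pair x y
  ∣p∣≡2∧x,y∈p⇒pair x≢y x∈p y∈p with ∣p∣≡2∧x∈p⇒pair x∈p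
  ... | z , x≢z , refl with ∈pair⁻ y∈p
  ...   | inj₁ refl = contradiction refl x≢y
  ...   | inj₂ refl = refl

module _ {m : ℕ} {p q : Subset m} where

  ∣Δ∣≡∣∣+∣∣ : Empty (p ∩ q) → ∣ p Δ q ∣ ≡ ∣ p ∣ + ∣ q ∣
  ∣Δ∣≡∣∣+∣∣ disjoint = begin
    ∣ p Δ q ∣                           ≡⟨ sym (+-identityʳ _) ⟩
    ∣ p Δ q ∣ + 0                       ≡⟨ cong (λ k → ∣ p Δ q ∣ + (k + k)) ∣p∩q∣≡0 ⟨
    ∣ p Δ q ∣ + (∣ p ∩ q ∣ + ∣ p ∩ q ∣) ≡⟨ ∣Δ∣+2∣∩∣≡∣∣+∣∣ p q ⟩
    ∣ p ∣ + ∣ q ∣                       ∎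
    where
    open ≡-Reasoning
    ∣p∩q∣≡0 = Empty⇒∣p∣≡0 disjoint

  ∣Δ∣≤3-of-meet : ∣ p ∣ ≤ 2 → ∣ q ∣ ≤ 2 → Nonempty (p ∩ q) → ∣ p Δ q ∣ ≤ 3
  ∣Δ∣≤3-of-meet ∣p∣≤2 ∣q∣≤2 (x , x∈p∩q) =
    m≤n⇒m≤1+n (+-cancelʳ-≤ 2 ∣ p Δ q ∣ 2 (begin
    ∣ p Δ q ∣ + 2       ≤⟨ +-monoʳ-≤ ∣ p Δ q ∣ (+-mono-≤ 1≤k 1≤k) ⟩
    ∣ p Δ q ∣ + (k + k) ≡⟨ ∣Δ∣+2∣∩∣≡∣∣+∣∣ p q ⟩
    ∣ p ∣ + ∣ q ∣       ≤⟨ +-mono-≤ ∣p∣≤2 ∣q∣≤2 ⟩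
    2 + 2               ∎))
    where
    open ≤-Reasoning
    k = ∣ p ∩ q ∣
    1≤k : 1 ≤ k
    1≤k = subst (_≤ k) (∣⁅x⁆∣≡1 x) (p⊆q⇒∣p∣≤∣q∣ (x∈p⇒⁅x⁆⊆p x∈p∩q))

  ∣Δ∣≤3-of-∣p∣≡1 : ∣ p ∣ ≡ 1 → ∣ q ∣ ≤ 2 → ∣ p Δ q ∣ ≤ 3
  ∣Δ∣≤3-of-∣p∣≡1 ∣p∣≡1 ∣q∣≤2 = begin
    ∣ p Δ q ∣                       ≤⟨ m≤m+n _ _ ⟩
    ∣ p Δ q ∣ + (∣ p ∩ q ∣ + ∣ p ∩ q ∣) ≡⟨ ∣Δ∣+2∣∩∣≡∣∣+∣∣ p q ⟩
    ∣ p ∣ + ∣ q ∣                    ≡⟨ cong (_+ ∣ q ∣) ∣p∣≡1 ⟩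
    1 + ∣ q ∣                        ≤⟨ s≤s ∣q∣≤2 ⟩
    3                                ∎
    where open ≤-Reasoning

  meet-of-∣Δ∣≤3 : ∣ p ∣ ≡ 2 → ∣ q ∣ ≡ 2 → ∣ p Δ q ∣ ≤ 3 → Nonempty (p ∩ q)
  meet-of-∣Δ∣≤3 ∣p∣≡2 ∣q∣≡2 ∣pΔq∣≤3 with nonempty? (p ∩ q)
  ... | yes meet     = meet
  ... | no  disjoint
    with s≤s (s≤s (s≤s ())) ←
      subst (_≤ 3) (trans (∣Δ∣≡∣∣+∣∣ disjoint) (cong₂ _+_ ∣p∣≡2 ∣q∣≡2)) ∣pΔq∣≤3

module _ {m : ℕ} {p : Subset m} {x : Fin m} (∣p∣≡2 : ∣ p ∣ ≡ 2) where

  x∈p⇒∣⁅x⁆Δp∣≡1 : x ∈ p → ∣ ⁅ x ⁆ Δ p ∣ ≡ 1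
  x∈p⇒∣⁅x⁆Δp∣≡1 x∈p = begin
    ∣ ⁅ x ⁆ Δ p ∣ ≡⟨ cong ∣_∣ (Δ-comm ⁅ x ⁆ p) ⟩
    ∣ p Δ ⁅ x ⁆ ∣ ≡⟨ x∈p⇒∣pΔ⁅x⁆∣≡∣p∣∸1 x∈p ⟩
    ∣ p ∣ ∸ 1     ≡⟨ cong (_∸ 1) ∣p∣≡2 ⟩
    1             ∎
    where open ≡-Reasoning

  ∣⁅x⁆Δp∣≡1⇒x∈p : ∣ ⁅ x ⁆ Δ p ∣ ≡ 1 → x ∈ p
  ∣⁅x⁆Δp∣≡1⇒x∈p ∣⁅x⁆Δp∣≡1 with x ∈? p
  ... | yes x∈p = x∈p
  ... | no  x∉p
    with () ← trans (sym ∣⁅x⁆Δp∣≡1)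
                (trans (∣Δ∣≡∣∣+∣∣ (x∉p⇒Empty[⁅x⁆∩p] x∉p)) (cong₂ _+_ (∣⁅x⁆∣≡1 x) ∣p∣≡2))

Side : ∀ {m} → Fin m → Fin m → Fin m → Subset m → Set
Side a b c D = D ≡ pair a b ⊎ D ≡ pair a c ⊎ D ≡ pair b c

module _ {m : ℕ} {a b c : Fin m} where

  sides-meet : ∀ {D D′} → Side a b c D → Side a b c D′ → Nonempty (D ∩ D′)
  sides-meet (inj₁ refl)        (inj₁ refl)        = ∈∩⇒Nonempty x∈pair x∈pair
  sides-meet (inj₁ refl)        (inj₂ (inj₁ refl)) = ∈∩⇒Nonempty x∈pair x∈pair
  sides-meet (inj₁ refl)        (inj₂ (inj₂ refl)) = ∈∩⇒Nonempty y∈pair x∈pair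
  sides-meet (inj₂ (inj₁ refl)) (inj₁ refl)        = ∈∩⇒Nonempty x∈pair x∈pair
  sides-meet (inj₂ (inj₁ refl)) (inj₂ (inj₁ refl)) = ∈∩⇒Nonempty x∈pair x∈pair
  sides-meet (inj₂ (inj₁ refl)) (inj₂ (inj₂ refl)) = ∈∩⇒Nonempty y∈pair y∈pair
  sides-meet (inj₂ (inj₂ refl)) (inj₁ refl)        = ∈∩⇒Nonempty x∈pair y∈pair
  sides-meet (inj₂ (inj₂ refl)) (inj₂ (inj₁ refl)) = ∈∩⇒Nonempty y∈pair y∈pair
  sides-meet (inj₂ (inj₂ refl)) (inj₂ (inj₂ refl)) = ∈∩⇒Nonempty x∈pair x∈pair

  meets-sides⇒side : a ≢ b → a ≢ c → b ≢ c → ∀ {D} → ∣ D ∣ ≡ 2 →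
                     (∀ {E} → Side a b c E → Nonempty (E ∩ D)) → Side a b c D
  meets-sides⇒side a≢b a≢c b≢c ∣D∣≡2 meets
    with pair-meet⁻ (meets (inj₁ refl))
  ... | inj₁ a∈D with pair-meet⁻ (meets (inj₂ (inj₂ refl)))
  ...   | inj₁ b∈D = inj₁ (∣p∣≡2∧x,y∈p⇒pair ∣D∣≡2 a≢b a∈D b∈D)
  ...   | inj₂ c∈D = inj₂ (inj₁ (∣p∣≡2∧x,y∈p⇒pair ∣D∣≡2 a≢c a∈D c∈D))
  meets-sides⇒side a≢b a≢c b≢c ∣D∣≡2 meets
      | inj₂ b∈D with pair-meet⁻ (meets (inj₂ (inj₁ refl)))
  ...   | inj₁ a∈D = inj₁ (∣p∣≡2∧x,y∈p⇒pair ∣D∣≡2 a≢b a∈D b∈D)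
  ...   | inj₂ c∈D = inj₂ (inj₂ (∣p∣≡2∧x,y∈p⇒pair ∣D∣≡2 b≢c b∈D c∈D))

module IntersectingPairs
  {m : ℕ} {E : Subset m → Set} (E? : Decidable E)
  (E-card : ∀ {D} → E D → ∣ D ∣ ≡ 2)
  (E-meet : ∀ {D D′} → E D → E D′ → Nonempty (D ∩ D′))
  where

  IsCentre : Fin m → Set
  IsCentre i = ∀ {D} → E D → i ∈ D

  record Triangle : Set where
    field
      a b c : Fin m
      a≢b   : a ≢ b
      a≢c   : a ≢ c
      b≢c   : b ≢ c
      sides : ∀ {D} → Side a b c D → E D

  triangle-absorbs : (t : Triangle) → let open Triangle t in ∀ {D} → E D → Side a b c D
  triangle-absorbs t e = meets-sides⇒side a≢b a≢c b≢c (E-card e) (λ side → E-meet (sides side) e)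
    where open Triangle t

  centre-or-avoided : ∀ i → IsCentre i ⊎ ∃ λ D → E D × i ∉ D
  centre-or-avoided i with anySubset? (λ D → E? D ×-dec ¬? (i ∈? D))
  ... | yes avoided = inj₂ avoided
  ... | no  ¬avoided = inj₁ λ {D} e → decidable-stable (i ∈? D) (λ i∉D → ¬avoided (D , e , i∉D))

  other-end : ∀ {x y D} → E (pair x y) → E D → x ∉ D → y ∈ D
  other-end exy e x∉D with pair-meet⁻ (E-meet exy e)
  ... | inj₁ x∈D = contradiction x∈D x∉D
  ... | inj₂ y∈D = y∈D

  -- If a is no centre, some edge bc avoids a; if b is no centre either, an edge
  -- avoiding b meets ab and bc, hence is ac.
  star-or-triangle : ∀ {D₀} → E D₀ → (∃ λ i → i ∈ D₀ × IsCentre i) ⊎ Triangle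
  star-or-triangle {D₀} e₀ with ∣p∣≡2⇒pair {p = D₀} (E-card e₀)
  ... | a , b , a≢b , refl with centre-or-avoided a
  ...   | inj₁ a-centre = inj₁ (a , x∈pair , a-centre)
  ...   | inj₂ (D₁ , e₁ , a∉D₁)
    with ∣p∣≡2∧x∈p⇒pair {p = D₁} (E-card e₁) (other-end e₀ e₁ a∉D₁)
  ...     | c , b≢c , refl with centre-or-avoided b
  ...       | inj₁ b-centre = inj₁ (b , y∈pair , b-centre)
  ...       | inj₂ (D₂ , e₂ , b∉D₂) = inj₂ (record
    { a = a ; b = b ; c = c ; a≢b = a≢b ; a≢c = a≢c ; b≢c = b≢c ; sides = sides })
    where
    a≢c : a ≢ c
    a≢c refl = a∉D₁ y∈pair
    D₂≡pair : D₂ ≡ pair a c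
    D₂≡pair = ∣p∣≡2∧x,y∈p⇒pair (E-card e₂) a≢c
                (other-end (subst E (pair-comm a b) e₀) e₂ b∉D₂) (other-end e₁ e₂ b∉D₂)
    sides : ∀ {D} → Side a b c D → E D
    sides (inj₁ refl)        = e₀
    sides (inj₂ (inj₁ refl)) = subst E D₂≡pair e₂
    sides (inj₂ (inj₂ refl)) = e₁

_HasDiameter≤_ : ∀ {m} → Family m → ℕ → Set
τ HasDiameter≤ r = ∀ C D → C ∈F τ → D ∈F τ → dist C D ≤ r

maximal-≐ : ∀ {m} {X σ τ : Family m} {r} → IsMaximalFace X r σ →
            σ ⊆F τ → τ ⊆F X → τ HasDiameter≤ r → σ ≐F τ
maximal-≐ (((C , C∈σ) , _) , maximal) σ⊆τ τ⊆X τ-diam D =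
  ⇔→≡ (mk⇔ (σ⊆τ D) (maximal _ ((C , σ⊆τ C C∈σ) , τ⊆X , τ-diam) σ⊆τ D))

module _ {m : ℕ} {C D : Subset m} where

  N-∋⁺ : ∣ C Δ D ∣ ≡ 1 → D ∈F N[ C ]
  N-∋⁺ ∣CΔD∣≡1 = ∨-≡true⁺ʳ ⌊ C ≟ D ⌋ (⌊⌋-≡true⁺ (∣ C Δ D ∣ ℕ.≟ 1) ∣CΔD∣≡1)

  N-∋⁻ : D ∈F N[ C ] → C ≡ D ⊎ ∣ C Δ D ∣ ≡ 1
  N-∋⁻ D∈N with ∨-≡true⁻ D∈N
  ... | inj₁ C≡D     = inj₁ (⌊⌋-≡true⁻ (C ≟ D) C≡D)
  ... | inj₂ ∣CΔD∣≡1 = inj₂ (⌊⌋-≡true⁻ (∣ C Δ D ∣ ℕ.≟ 1) ∣CΔD∣≡1)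

  module _ {a b c : Fin m} where

    H-∋⁺ : Side a b c (C Δ D) → D ∈F H C a b c
    H-∋⁺ side = ∨-≡true⁺ʳ ⌊ C ≟ D ⌋ (on-side side)
      where
      ∋D : ∀ {X} → C Δ D ≡ X → singletonF (C Δ X) D ≡ true
      ∋D {X} eq = ⌊⌋-≡true⁺ ((C Δ X) ≟ D) (Δ-transpose eq)
      on-side : Side a b c (C Δ D) → (singletonF (C ^[ a , b ]) ∪F
                  (singletonF (C ^[ a , c ]) ∪F singletonF (C ^[ b , c ]))) D ≡ true
      on-side (inj₁ eq)        = ∨-≡true⁺ˡ _ (∋D eq)
      on-side (inj₂ (inj₁ eq)) = ∨-≡true⁺ʳ (singletonF (C ^[ a , b ]) D) (∨-≡true⁺ˡ _ (∋D eq))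
      on-side (inj₂ (inj₂ eq)) = ∨-≡true⁺ʳ (singletonF (C ^[ a , b ]) D)
                                   (∨-≡true⁺ʳ (singletonF (C ^[ a , c ]) D) (∋D eq))

    H-∋⁻ : D ∈F H C a b c → C ≡ D ⊎ Side a b c (C Δ D)
    H-∋⁻ D∈H with ∨-≡true⁻ D∈H
    ... | inj₁ C≡D = inj₁ (⌊⌋-≡true⁻ (C ≟ D) C≡D)
    ... | inj₂ D∈sides with ∨-≡true⁻ D∈sides
    ...   | inj₁ eq = inj₂ (inj₁ (Δ-transpose (⌊⌋-≡true⁻ ((C ^[ a , b ]) ≟ D) eq)))
    ...   | inj₂ D∈sides′ with ∨-≡true⁻ D∈sides′
    ...     | inj₁ eq = inj₂ (inj₂ (inj₁ (Δ-transpose (⌊⌋-≡true⁻ ((C ^[ a , c ]) ≟ D) eq))))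
    ...     | inj₂ eq = inj₂ (inj₂ (inj₂ (Δ-transpose (⌊⌋-≡true⁻ ((C ^[ b , c ]) ≟ D) eq))))

G-∋⁻ : ∀ {m} {A B : Subset m} {ℓ} → B ∈F G A ℓ →
       B ─ A ≡ ⁅ ℓ ⁆ × (∣ B ∣ ≡ ∣ A ∣ ⊎ ∣ B ∣ ≡ ∣ A ∣ ∸ 1)
G-∋⁻ {A = A} {B} {ℓ} B∈G with ∧-≡true⁻ B∈G
... | B─A≡⁅ℓ⁆ , ∣B∣≡ = ⌊⌋-≡true⁻ ((B ─ A) ≟ ⁅ ℓ ⁆) B─A≡⁅ℓ⁆ , sizes (∨-≡true⁻ ∣B∣≡)
  where
  sizes : _ ⊎ _ → ∣ B ∣ ≡ ∣ A ∣ ⊎ ∣ B ∣ ≡ ∣ A ∣ ∸ 1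
  sizes (inj₁ e) = inj₁ (⌊⌋-≡true⁻ (∣ B ∣ ℕ.≟ ∣ A ∣) e)
  sizes (inj₂ e) = inj₂ (⌊⌋-≡true⁻ (∣ B ∣ ℕ.≟ ∣ A ∣ ∸ 1) e)

module Coordinates {m : ℕ} {A : Subset m} {ℓ : Fin m} (ℓ∉A : ℓ ∉ A) where

  S : Subset m
  S = ⁅ ℓ ⁆ ∪ A

  δ : Subset m → Subset m
  δ C = S Δ C

  module _ {C : Subset m} (C∈G : C ∈F G A ℓ) where

    private
      C─A≡⁅ℓ⁆ : C ─ A ≡ ⁅ ℓ ⁆
      C─A≡⁅ℓ⁆ = proj₁ (G-∋⁻ {A = A} {C} {ℓ} C∈G)
      ∣C∣≡ : ∣ C ∣ ≡ ∣ A ∣ ⊎ ∣ C ∣ ≡ ∣ A ∣ ∸ 1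
      ∣C∣≡ = proj₂ (G-∋⁻ {A = A} {C} {ℓ} C∈G)

    C⊆S : C ⊆ S
    C⊆S {x} x∈C with x ∈? A
    ... | yes x∈A = x∈p∪q⁺ (inj₂ x∈A)
    ... | no  x∉A = x∈p∪q⁺ (inj₁ (subst (x ∈_) C─A≡⁅ℓ⁆ (x∈p∧x∉q⇒x∈p─q x∈C x∉A)))

    ℓ∈C : ℓ ∈ C
    ℓ∈C = p─q⊆p C A (subst (ℓ ∈_) (sym C─A≡⁅ℓ⁆) (x∈⁅x⁆ ℓ))

    δ⊆A : δ C ⊆ A
    δ⊆A x∈δC with ∈Δ-⊆⁻ C⊆S x∈δC
    ... | x∈S , x∉C with x∈p∪q⁻ ⁅ ℓ ⁆ A x∈S
    ...   | inj₁ x∈⁅ℓ⁆ = contradiction (subst (_∈ C) (sym (x∈⁅y⁆⇒x≡y ℓ x∈⁅ℓ⁆)) ℓ∈C) x∉C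
    ...   | inj₂ x∈A   = x∈A

    ∣δ∣≡1⊎2 : ∣ δ C ∣ ≡ 1 ⊎ ∣ δ C ∣ ≡ 2
    ∣δ∣≡1⊎2 = sizes (∣ δ C ∣) (∣ C ∣) (∣ A ∣)
      (trans (∣Δ∣+∣∣≡∣∣ C⊆S) (∣⁅x⁆∪p∣≡1+∣p∣ ℓ∉A)) ∣C∣≡
      where
      -- for a = 0 the truncated a ∸ 1 is a itself, so d = 1 there as well
      sizes : ∀ d c a → d + c ≡ suc a → c ≡ a ⊎ c ≡ a ∸ 1 → d ≡ 1 ⊎ d ≡ 2
      sizes d c a       e (inj₁ refl) = inj₁ (+-cancelʳ-≡ c d 1 e)
      sizes d c 0       e (inj₂ refl) = inj₁ (+-cancelʳ-≡ c d 1 e)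
      sizes d c (suc a) e (inj₂ refl) = inj₂ (+-cancelʳ-≡ c d 2 e)

    ∣δ∣≤2 : ∣ δ C ∣ ≤ 2
    ∣δ∣≤2 with ∣δ∣≡1⊎2
    ... | inj₁ ∣δC∣≡1 = subst (_≤ 2) (sym ∣δC∣≡1) (s≤s z≤n)
    ... | inj₂ ∣δC∣≡2 = ≤-reflexive ∣δC∣≡2

    0<∣δ∣ : 0 < ∣ δ C ∣
    0<∣δ∣ with ∣δ∣≡1⊎2
    ... | inj₁ ∣δC∣≡1 = subst (0 <_) (sym ∣δC∣≡1) (s≤s z≤n)
    ... | inj₂ ∣δC∣≡2 = subst (0 <_) (sym ∣δC∣≡2) (s≤s z≤n)

  face : Family m → Family m
  face F = G A ℓ ∩F (N[ S ] ∪F F)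

  module _ {F : Family m} where

    face-∋⁺ : ∀ {C} → C ∈F G A ℓ → (∣ δ C ∣ ≡ 2 → C ∈F F) → C ∈F face F
    face-∋⁺ {C} C∈G ∣δC∣≡2⇒C∈F with ∣δ∣≡1⊎2 C∈G
    ... | inj₁ ∣δC∣≡1 = ∧-≡true⁺ C∈G (∨-≡true⁺ˡ _ (N-∋⁺ {C = S} ∣δC∣≡1))
    ... | inj₂ ∣δC∣≡2 = ∧-≡true⁺ C∈G (∨-≡true⁺ʳ _ (∣δC∣≡2⇒C∈F ∣δC∣≡2))

    face-∋⁻ : ∀ {C} → C ∈F face F → ∣ δ C ∣ ≡ 2 → C ∈F F
    face-∋⁻ {C} C∈face ∣δC∣≡2 with ∨-≡true⁻ (proj₂ (∧-≡true⁻ C∈face))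
    ... | inj₂ C∈F    = C∈F
    ... | inj₁ C∈N[S] with N-∋⁻ {C = S} {C} C∈N[S]
    ...   | inj₁ refl     with () ← trans (sym ∣δC∣≡2) (∣pΔp∣≡0 S)
    ...   | inj₂ ∣δC∣≡1 with () ← trans (sym ∣δC∣≡2) ∣δC∣≡1

    face⊆G : face F ⊆F G A ℓ
    face⊆G C C∈face = proj₁ (∧-≡true⁻ C∈face)

    face-diameter≤3 : {P : Subset m → Set} → (∀ {D D′} → P D → P D′ → Nonempty (D ∩ D′)) →
                      (∀ {C} → C ∈F F → ∣ δ C ∣ ≡ 2 → P (δ C)) → face F HasDiameter≤ 3
    face-diameter≤3 P-meet F⇒P C D C∈face D∈face =
      subst (_≤ 3) (dist-Δˡ S C D) (∣δΔδ∣≤3 (∣δ∣≡1⊎2 C∈G) (∣δ∣≡1⊎2 D∈G))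
      where
      C∈G = face⊆G C C∈face
      D∈G = face⊆G D D∈face
      ∣δΔδ∣≤3 : _ → _ → ∣ δ C Δ δ D ∣ ≤ 3
      ∣δΔδ∣≤3 (inj₁ ∣δC∣≡1) _ = ∣Δ∣≤3-of-∣p∣≡1 {p = δ C} ∣δC∣≡1 (∣δ∣≤2 D∈G)
      ∣δΔδ∣≤3 (inj₂ _) (inj₁ ∣δD∣≡1) =
        subst (_≤ 3) (cong ∣_∣ (Δ-comm (δ D) (δ C))) (∣Δ∣≤3-of-∣p∣≡1 {p = δ D} ∣δD∣≡1 (∣δ∣≤2 C∈G))
      ∣δΔδ∣≤3 (inj₂ ∣δC∣≡2) (inj₂ ∣δD∣≡2) = ∣Δ∣≤3-of-meet {p = δ C} (∣δ∣≤2 C∈G) (∣δ∣≤2 D∈G)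
        (P-meet (F⇒P (face-∋⁻ C∈face ∣δC∣≡2) ∣δC∣≡2) (F⇒P (face-∋⁻ D∈face ∣δD∣≡2) ∣δD∣≡2))

  module _ {i : Fin m} {C : Subset m} (∣δC∣≡2 : ∣ δ C ∣ ≡ 2) where

    private
      ∣SΔ⁅i⁆ΔC∣≡∣⁅i⁆ΔδC∣ : ∣ (S Δ ⁅ i ⁆) Δ C ∣ ≡ ∣ ⁅ i ⁆ Δ δ C ∣
      ∣SΔ⁅i⁆ΔC∣≡∣⁅i⁆ΔδC∣ = cong ∣_∣ (Δ-swap S ⁅ i ⁆ C)

    star-∋⁺ : i ∈ δ C → C ∈F N[ S Δ ⁅ i ⁆ ]
    star-∋⁺ i∈δC = N-∋⁺ {C = S Δ ⁅ i ⁆} (trans ∣SΔ⁅i⁆ΔC∣≡∣⁅i⁆ΔδC∣ (x∈p⇒∣⁅x⁆Δp∣≡1 ∣δC∣≡2 i∈δC))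

    star-∋⁻ : C ∈F N[ S Δ ⁅ i ⁆ ] → i ∈ δ C
    star-∋⁻ C∈N with N-∋⁻ {C = S Δ ⁅ i ⁆} {C} C∈N
    ... | inj₁ refl   = subst (i ∈_) (sym (Δ-cancelˡ S ⁅ i ⁆)) (x∈⁅x⁆ i)
    ... | inj₂ dist≡1 = ∣⁅x⁆Δp∣≡1⇒x∈p ∣δC∣≡2 (trans (sym ∣SΔ⁅i⁆ΔC∣≡∣⁅i⁆ΔδC∣) dist≡1)

  triangle-∋⁻ : ∀ {a b c C} → C ∈F H S a b c → ∣ δ C ∣ ≡ 2 → Side a b c (δ C)
  triangle-∋⁻ {C = C} C∈H ∣δC∣≡2 with H-∋⁻ {C = S} {C} C∈H
  ... | inj₂ side = side
  ... | inj₁ refl with () ← trans (sym ∣δC∣≡2) (∣pΔp∣≡0 S)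

  starFace-diameter≤3 : ∀ i → face N[ S Δ ⁅ i ⁆ ] HasDiameter≤ 3
  starFace-diameter≤3 i = face-diameter≤3 {P = i ∈_} ∈∩⇒Nonempty (λ C∈N ∣δC∣≡2 → star-∋⁻ ∣δC∣≡2 C∈N)

  triangleFace-diameter≤3 : ∀ a b c → face (H S a b c) HasDiameter≤ 3
  triangleFace-diameter≤3 a b c = face-diameter≤3 {P = Side a b c} sides-meet triangle-∋⁻

  SΔ⁅i⁆≡⁅ℓ⁆∪[AΔ⁅i⁆] : ∀ {i} → i ∈ A → S Δ ⁅ i ⁆ ≡ ⁅ ℓ ⁆ ∪ (A Δ ⁅ i ⁆)
  SΔ⁅i⁆≡⁅ℓ⁆∪[AΔ⁅i⁆] {i} i∈A = begin
    (⁅ ℓ ⁆ ∪ A) Δ ⁅ i ⁆   ≡⟨ cong (_Δ ⁅ i ⁆) (⁅x⁆∪p≡⁅x⁆Δp ℓ∉A) ⟩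
    (⁅ ℓ ⁆ Δ A) Δ ⁅ i ⁆   ≡⟨ Δ-assoc ⁅ ℓ ⁆ A ⁅ i ⁆ ⟩
    ⁅ ℓ ⁆ Δ (A Δ ⁅ i ⁆)   ≡⟨ sym (⁅x⁆∪p≡⁅x⁆Δp (λ ℓ∈AΔ⁅i⁆ → ℓ∉A (pΔ⁅x⁆⊆p i∈A ℓ∈AΔ⁅i⁆))) ⟩
    ⁅ ℓ ⁆ ∪ (A Δ ⁅ i ⁆)   ∎
    where open ≡-Reasoning

module MaximalFace
  {m : ℕ} {A : Subset m} {ℓ : Fin m} (ℓ∉A : ℓ ∉ A)
  {σ : Family m} (σ-max : IsMaximalFace (G A ℓ) 3 σ)
  where

  open Coordinates ℓ∉A

  σ⊆G : σ ⊆F G A ℓ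
  σ⊆G = proj₁ (proj₂ (proj₁ σ-max))

  Edge : Subset m → Set
  Edge D = (S Δ D) ∈F σ × ∣ D ∣ ≡ 2

  edge? : Decidable Edge
  edge? D = (σ (S Δ D) Bool.≟ true) ×-dec (∣ D ∣ ℕ.≟ 2)

  edge⊆A : ∀ {D} → Edge D → D ⊆ A
  edge⊆A {D} (SΔD∈σ , _) = subst (_⊆ A) (Δ-cancelˡ S D) (δ⊆A (σ⊆G _ SΔD∈σ))

  edge-meet : ∀ {D D′} → Edge D → Edge D′ → Nonempty (D ∩ D′)
  edge-meet {D} {D′} (SΔD∈σ , ∣D∣≡2) (SΔD′∈σ , ∣D′∣≡2) = meet-of-∣Δ∣≤3 ∣D∣≡2 ∣D′∣≡2
    (subst (_≤ 3) (dist-Δˡ S D D′) (proj₂ (proj₂ (proj₁ σ-max)) _ _ SΔD∈σ SΔD′∈σ))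

  δ-edge : ∀ {C} → C ∈F σ → ∣ δ C ∣ ≡ 2 → Edge (δ C)
  δ-edge {C} C∈σ ∣δC∣≡2 = subst (_∈F σ) (sym (Δ-cancelˡ S C)) C∈σ , ∣δC∣≡2

  open IntersectingPairs edge? proj₂ edge-meet public

  σ≐starFace : ∀ {i} → IsCentre i → σ ≐F face N[ S Δ ⁅ i ⁆ ]
  σ≐starFace {i} centre =
    maximal-≐ σ-max σ⊆starFace (face⊆G {F = N[ S Δ ⁅ i ⁆ ]}) (starFace-diameter≤3 i)
    where
    σ⊆starFace : σ ⊆F face N[ S Δ ⁅ i ⁆ ]
    σ⊆starFace C C∈σ =
      face-∋⁺ {F = N[ S Δ ⁅ i ⁆ ]} (σ⊆G C C∈σ) λ ∣δC∣≡2 →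
        star-∋⁺ {C = C} ∣δC∣≡2 (centre (δ-edge C∈σ ∣δC∣≡2))

  σ≐triangleFace : (t : Triangle) → let open Triangle t in σ ≐F face (H S a b c)
  σ≐triangleFace t =
    maximal-≐ σ-max σ⊆triangleFace (face⊆G {F = H S a b c}) (triangleFace-diameter≤3 a b c)
    where
    open Triangle t
    σ⊆triangleFace : σ ⊆F face (H S a b c)
    σ⊆triangleFace C C∈σ =
      face-∋⁺ {F = H S a b c} (σ⊆G C C∈σ) λ ∣δC∣≡2 →
        H-∋⁺ {C = S} (triangle-absorbs t (δ-edge C∈σ ∣δC∣≡2))

  centre-or-triangle : (∃ λ i → i ∈ A × IsCentre i) ⊎ Triangle
  centre-or-triangle with anySubset? edge?
  ... | yes (D₀ , e₀) with star-or-triangle e₀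
  ...   | inj₁ (i , i∈D₀ , centre) = inj₁ (i , edge⊆A e₀ i∈D₀ , centre)
  ...   | inj₂ triangle            = inj₂ triangle
  -- without edges every vertex is a centre, in particular one of δ C₀ ⊆ A
  centre-or-triangle | no ¬edge with proj₁ (proj₁ σ-max)
  ... | C₀ , C₀∈σ with 0<∣p∣⇒Nonempty (0<∣δ∣ {C₀} (σ⊆G C₀ C₀∈σ))
  ...   | i , i∈δC₀ =
    inj₁ (i , δ⊆A {C₀} (σ⊆G C₀ C₀∈σ) i∈δC₀ , λ {D} e → contradiction (D , e) ¬edge)

lemma4p2 : (m : ℕ) (A : Subset m) (ℓ : Fin m) → ℓ ∉ A →
    (σ : Family m) → IsMaximalFace (G A ℓ) 3 σ →
    (Σ (Subset m) λ B → B ⊆ A × ∣ B ∣ ≡ ∣ A ∣ ∸ 1 ×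
       (σ ≐F (G A ℓ ∩F (N[ ⁅ ℓ ⁆ ∪ A ] ∪F N[ ⁅ ℓ ⁆ ∪ B ]))))
    ⊎
    (Σ (Fin m) λ a → Σ (Fin m) λ b → Σ (Fin m) λ c →
       a ∈ A × b ∈ A × c ∈ A × a ≢ b × a ≢ c × b ≢ c ×
       (σ ≐F (G A ℓ ∩F (N[ ⁅ ℓ ⁆ ∪ A ] ∪F H (⁅ ℓ ⁆ ∪ A) a b c))))
lemma4p2 m A ℓ ℓ∉A σ σ-max with MaximalFace.centre-or-triangle ℓ∉A σ-max
... | inj₁ (i , i∈A , centre) =
  inj₁ (A Δ ⁅ i ⁆ , pΔ⁅x⁆⊆p i∈A , x∈p⇒∣pΔ⁅x⁆∣≡∣p∣∸1 i∈A ,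
        subst (λ B → σ ≐F face N[ B ]) (SΔ⁅i⁆≡⁅ℓ⁆∪[AΔ⁅i⁆] i∈A) (σ≐starFace centre))
  where open Coordinates ℓ∉A; open MaximalFace ℓ∉A σ-max
... | inj₂ t =
  inj₂ (a , b , c , edge⊆A (sides (inj₁ refl)) x∈pair , edge⊆A (sides (inj₁ refl)) y∈pair ,
        edge⊆A (sides (inj₂ (inj₁ refl))) y∈pair , a≢b , a≢c , b≢c , σ≐triangleFace t)
  where open MaximalFace ℓ∉A σ-max; open Triangle t
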